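{- Let $n\ge2$ and let $L_{n,cyc}$ be the $(n-1)\times(n-1)$ tridiagonal matrix (indices $1,\ldots,n-1$) with diagonal entries $2$, sub- and superdiagonal entries $-1$, and other entries $0$. Let $\Pi_n$ be the half-open fundamental parallelepiped spanned by the columns $u_1,\ldots,u_{n-1}$ of $nL_{n,cyc}^{ -1}$, i.e. $\Pi_n=\{\sum_j t_ju_j: 0\le t_j<1\}$. Suppose $x=(x_1,\ldots,x_{n-1})\in\Pi_n$ is of the form $x=L_{n,cyc}^{ -1}c$ for some vector $c$ with entries in $\{0,1,\ldots,n-1\}$. Then $x$ is an integer point if and only if $x_1$ is an integer. -}

module Defs where

open import Data.Nat as ℕ using (ℕ; zero; suc; _≡ᵇ_)
open import Data.Bool using (if_then_else_; _∨_)
open import Data.Fin using (Fin; toℕ; zero; suc)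
open import Data.Integer using (ℤ; +_; -[1+_])
open import Data.Rational using (ℚ; _/_; 0ℚ; 1ℚ; _+_; _*_)
open import Data.Product using (∃)
open import Relation.Binary.PropositionalEquality using (_≡_)

sumFin : ∀ {m} → (Fin m → ℚ) → ℚ
sumFin {zero}  f = 0ℚ
sumFin {suc m} f = f zero + sumFin (λ i → f (suc i))

Mat : ℕ → Set
Mat m = Fin m → Fin m → ℚ

_·_ : ∀ {m} → Mat m → Mat m → Mat m
(A · B) i j = sumFin (λ k → A i k * B k j)

idMat : ∀ {m} → Mat m
idMat i j = if toℕ i ≡ᵇ toℕ j then 1ℚ else 0ℚ

-- The tridiagonal matrix L_{n,cyc} of size m = n-1:
-- 2 on the diagonal, -1 on the sub/superdiagonal, 0 elsewhere.
Lcyc : ∀ m → Mat m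
Lcyc m i j =
  if toℕ i ≡ᵇ toℕ j then + 2 / 1
  else (if (suc (toℕ i) ≡ᵇ toℕ j) ∨ (toℕ i ≡ᵇ suc (toℕ j)) then -[1+ 0 ] / 1 else 0ℚ)

IsInverse : ∀ {m} → Mat m → Mat m → Set
IsInverse {m} A M = (∀ i j → (A · M) i j ≡ idMat i j) Data.Product.× (∀ i j → (M · A) i j ≡ idMat i j)

IsInt : ℚ → Set
IsInt q = ∃ λ (z : ℤ) → q ≡ z / 1

-- L x = c has integer entries, and since L is tridiagonal with entries 2, -1, -1
-- each row is the three-term recurrence x_{a+1} = 2 x_a - x_{a-1} - c_a
-- (with x_0 = x_n = 0 in the paper's indexing). Integer combinations of integers
-- are integers, so x_1 ∈ ℤ forces every x_a ∈ ℤ by induction on a.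
module Submission where

open import Defs
open import Data.Nat using (ℕ; suc)
open import Data.Fin using (Fin; toℕ; zero)
open import Data.Integer using (+_)
open import Data.Rational using (ℚ; _/_; 0ℚ; 1ℚ; _*_; _≤_; _<_)
open import Data.Product using (∃; _×_)
open import Function.Bundles using (_⇔_)
open import Relation.Binary.PropositionalEquality using (_≡_)

open import Data.Bool using (Bool; if_then_else_)
open import Data.Fin using (suc; fromℕ<)
open import Data.Fin.Properties using (toℕ-fromℕ<)
open import Data.Integer as ℤ using (-[1+_])
import Data.Integer.Properties as ℤ
open import Data.Nat as ℕ using (_≡ᵇ_; _<?_; s≤s)
import Data.Nat.Properties as ℕ
open import Data.Product using (_,_; proj₂)
open import Data.Rational using (_+_)
open import Data.Rational.Properties
  using (*-zeroˡ; *-zeroʳ; *-identityˡ; +-identityˡ; +-identityʳ; *-distribˡ-+; *-comm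
        ; toℚᵘ-injective; toℚᵘ-fromℚᵘ; toℚᵘ-homo-+; toℚᵘ-homo-*)
open import Data.Rational.Solver using (module +-*-Solver)
import Data.Rational.Unnormalised as ℚᵘ
import Data.Rational.Unnormalised.Properties as ℚᵘ
open import Function.Bundles using (mk⇔)
open import Relation.Binary.PropositionalEquality
  using (refl; sym; trans; cong; cong₂; subst; module ≡-Reasoning)
open import Relation.Nullary using (yes; no)

open +-*-Solver

sumFin-cong : ∀ {m} {f g : Fin m → ℚ} → (∀ j → f j ≡ g j) → sumFin f ≡ sumFin g
sumFin-cong {ℕ.zero} f≡g = refl
sumFin-cong {suc m}  f≡g = cong₂ _+_ (f≡g zero) (sumFin-cong (λ j → f≡g (suc j)))

sumFin-zero : ∀ {m} (f : Fin m → ℚ) → (∀ j → f j ≡ 0ℚ) → sumFin f ≡ 0ℚ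
sumFin-zero {ℕ.zero} f f≡0 = refl
sumFin-zero {suc m}  f f≡0 = cong₂ _+_ (f≡0 zero) (sumFin-zero (λ j → f (suc j)) (λ j → f≡0 (suc j)))

sumFin-+ : ∀ {m} (f g : Fin m → ℚ) → sumFin (λ j → f j + g j) ≡ sumFin f + sumFin g
sumFin-+ {ℕ.zero} f g = refl
sumFin-+ {suc m}  f g = trans
  (cong (_+_ (f zero + g zero)) (sumFin-+ (λ j → f (suc j)) (λ j → g (suc j))))
  (+-interchange (f zero) (g zero) _ _)
  where
  +-interchange : ∀ a b c d → (a + b) + (c + d) ≡ (a + c) + (b + d)
  +-interchange = solve 4 (λ a b c d → (a :+ b) :+ (c :+ d) := (a :+ c) :+ (b :+ d)) refl

sumFin-*ˡ : ∀ {m} (a : ℚ) (f : Fin m → ℚ) → sumFin (λ j → a * f j) ≡ a * sumFin f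
sumFin-*ˡ {ℕ.zero} a f = sym (*-zeroʳ a)
sumFin-*ˡ {suc m}  a f = trans
  (cong (_+_ (a * f zero)) (sumFin-*ˡ a (λ j → f (suc j))))
  (sym (*-distribˡ-+ a (f zero) _))

sumFin-swap : ∀ {m p} (f : Fin m → Fin p → ℚ) →
  sumFin (λ j → sumFin (λ l → f j l)) ≡ sumFin (λ l → sumFin (λ j → f j l))
sumFin-swap {ℕ.zero} {p} f = sym (sumFin-zero {p} (λ _ → 0ℚ) (λ _ → refl))
sumFin-swap {suc m}  f = trans
  (cong (_+_ (sumFin (f zero))) (sumFin-swap (λ j → f (suc j))))
  (sym (sumFin-+ (f zero) (λ l → sumFin (λ j → f (suc j) l))))

indicator : Bool → ℚ
indicator b = if b then 1ℚ else 0ℚ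

-- x extended by zero to all of ℕ, written as an indicator sum so that it matches
-- the expansion of a row of Lcyc term by term.
extend : ∀ {m} → (Fin m → ℚ) → ℕ → ℚ
extend x a = sumFin (λ j → indicator (a ≡ᵇ toℕ j) * x j)

extend-toℕ : ∀ {m} (x : Fin m → ℚ) (i : Fin m) → extend x (toℕ i) ≡ x i
extend-toℕ x zero = trans
  (cong₂ _+_ (*-identityˡ (x zero)) (sumFin-zero _ (λ j → *-zeroˡ (x (suc j)))))
  (+-identityʳ (x zero))
extend-toℕ x (suc i) = trans
  (cong (_+ extend (λ j → x (suc j)) (toℕ i)) (*-zeroˡ (x zero)))
  (trans (+-identityˡ _) (extend-toℕ (λ j → x (suc j)) i))

extend-≥ : ∀ {m} (x : Fin m → ℚ) {a} → m ℕ.≤ a → extend x a ≡ 0ℚ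
extend-≥ {ℕ.zero} x         m≤a       = refl
extend-≥ {suc m}  x {suc a} (s≤s m≤a) = trans
  (cong (_+ extend (λ j → x (suc j)) a) (*-zeroˡ (x zero)))
  (trans (+-identityˡ _) (extend-≥ (λ j → x (suc j)) m≤a))

_*ᵥ_ : ∀ {m} → Mat m → (Fin m → ℚ) → Fin m → ℚ
(A *ᵥ x) i = sumFin (λ j → A i j * x j)

*ᵥ-assoc : ∀ {m} (A B : Mat m) (x : Fin m → ℚ) i → (A *ᵥ (B *ᵥ x)) i ≡ ((A · B) *ᵥ x) i
*ᵥ-assoc A B x i = begin
  sumFin (λ j → A i j * sumFin (λ l → B j l * x l))
    ≡⟨ sumFin-cong (λ j → sym (sumFin-*ˡ (A i j) (λ l → B j l * x l))) ⟩
  sumFin (λ j → sumFin (λ l → A i j * (B j l * x l)))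
    ≡⟨ sumFin-swap (λ j l → A i j * (B j l * x l)) ⟩
  sumFin (λ l → sumFin (λ j → A i j * (B j l * x l)))
    ≡⟨ sumFin-cong (λ l → trans (sumFin-cong (λ j → *-reassoc (A i j) (B j l) (x l)))
                                (sumFin-*ˡ (x l) (λ j → A i j * B j l))) ⟩
  sumFin (λ l → x l * (A · B) i l)
    ≡⟨ sumFin-cong (λ l → *-comm (x l) ((A · B) i l)) ⟩
  sumFin (λ l → (A · B) i l * x l) ∎
  where
  open ≡-Reasoning
  *-reassoc : ∀ a b c → a * (b * c) ≡ c * (a * b)
  *-reassoc = solve 3 (λ a b c → a :* (b :* c) := c :* (a :* b)) refl

idMat-*ᵥ : ∀ {m} (x : Fin m → ℚ) i → (idMat *ᵥ x) i ≡ x i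
idMat-*ᵥ x i = extend-toℕ x i

*ᵥ-rightInverse : ∀ {m} (A M : Mat m) → (∀ i j → (A · M) i j ≡ idMat i j) →
  ∀ x i → (A *ᵥ (M *ᵥ x)) i ≡ x i
*ᵥ-rightInverse A M A·M≡I x i =
  trans (*ᵥ-assoc A M x i) (trans (sumFin-cong (λ j → cong (_* x j) (A·M≡I i j))) (idMat-*ᵥ x i))

toℚᵘ-/1 : ∀ z → Data.Rational.toℚᵘ (z / 1) ℚᵘ.≃ ℚᵘ.mkℚᵘ z 0
toℚᵘ-/1 z = toℚᵘ-fromℚᵘ (ℚᵘ.mkℚᵘ z 0)

/1-+ : ∀ z w → (z / 1) + (w / 1) ≡ (z ℤ.+ w) / 1
/1-+ z w = toℚᵘ-injective (ℚᵘ.≃-trans (toℚᵘ-homo-+ (z / 1) (w / 1))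
  (ℚᵘ.≃-trans (ℚᵘ.+-cong (toℚᵘ-/1 z) (toℚᵘ-/1 w))
  (ℚᵘ.≃-trans (ℚᵘ.*≡* (cong (ℤ._* + 1) (cong₂ ℤ._+_ (ℤ.*-identityʳ z) (ℤ.*-identityʳ w))))
  (ℚᵘ.≃-sym (toℚᵘ-/1 (z ℤ.+ w))))))

/1-* : ∀ z w → (z / 1) * (w / 1) ≡ (z ℤ.* w) / 1
/1-* z w = toℚᵘ-injective (ℚᵘ.≃-trans (toℚᵘ-homo-* (z / 1) (w / 1))
  (ℚᵘ.≃-trans (ℚᵘ.*-cong (toℚᵘ-/1 z) (toℚᵘ-/1 w)) (ℚᵘ.≃-sym (toℚᵘ-/1 (z ℤ.* w)))))

IsInt-+ : ∀ {p q} → IsInt p → IsInt q → IsInt (p + q)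
IsInt-+ (z , refl) (w , refl) = z ℤ.+ w , /1-+ z w

IsInt-* : ∀ {p q} → IsInt p → IsInt q → IsInt (p * q)
IsInt-* (z , refl) (w , refl) = z ℤ.* w , /1-* z w

IsInt-0 : IsInt 0ℚ
IsInt-0 = + 0 , refl

2ℚ -1ℚ : ℚ
2ℚ  = + 2 / 1
-1ℚ = -[1+ 0 ] / 1

IsInt-2 : IsInt 2ℚ
IsInt-2 = + 2 , refl

IsInt--1 : IsInt -1ℚ
IsInt--1 = -[1+ 0 ] , refl

Lcyc-entry : ∀ {m} (i j : Fin m) → Lcyc m i j ≡
  2ℚ * indicator (toℕ i ≡ᵇ toℕ j) + -1ℚ * indicator (suc (toℕ i) ≡ᵇ toℕ j)
    + -1ℚ * indicator (toℕ i ≡ᵇ suc (toℕ j))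
Lcyc-entry zero           zero           = refl
Lcyc-entry zero           (suc zero)     = refl
Lcyc-entry zero           (suc (suc j))  = refl
Lcyc-entry (suc zero)     zero           = refl
Lcyc-entry (suc (suc i))  zero           = refl
Lcyc-entry {suc m} (suc i) (suc j)       = Lcyc-entry {m} i j

extend-previous : ∀ {m} → (Fin m → ℚ) → ℕ → ℚ
extend-previous x ℕ.zero    = 0ℚ
extend-previous x (suc a) = extend x a

sumFin-indicator-suc : ∀ {m} (x : Fin m → ℚ) a →
  sumFin (λ j → indicator (a ≡ᵇ suc (toℕ j)) * x j) ≡ extend-previous x a
sumFin-indicator-suc x ℕ.zero    = sumFin-zero _ (λ j → *-zeroˡ (x j))
sumFin-indicator-suc x (suc a) = refl

Lcyc-row : ∀ {m} (x : Fin m → ℚ) (i : Fin m) → (Lcyc m *ᵥ x) i ≡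
  2ℚ * extend x (toℕ i) + -1ℚ * extend x (suc (toℕ i)) + -1ℚ * extend-previous x (toℕ i)
Lcyc-row {m} x i = begin
  sumFin (λ j → Lcyc m i j * x j)
    ≡⟨ sumFin-cong (λ j → trans (cong (_* x j) (Lcyc-entry i j)) (distrib (I₁ j) (I₂ j) (I₃ j) (x j))) ⟩
  sumFin (λ j → 2ℚ * (I₁ j * x j) + -1ℚ * (I₂ j * x j) + -1ℚ * (I₃ j * x j))
    ≡⟨ trans (sumFin-+ {m} _ _) (cong (_+ sumFin (λ j → -1ℚ * (I₃ j * x j))) (sumFin-+ {m} _ _)) ⟩
  sumFin (λ j → 2ℚ * (I₁ j * x j)) + sumFin (λ j → -1ℚ * (I₂ j * x j)) + sumFin (λ j → -1ℚ * (I₃ j * x j))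
    ≡⟨ cong₂ _+_ (cong₂ _+_ (sumFin-*ˡ {m} 2ℚ _) (sumFin-*ˡ {m} -1ℚ _)) (sumFin-*ˡ {m} -1ℚ _) ⟩
  2ℚ * extend x a + -1ℚ * extend x (suc a) + -1ℚ * sumFin (λ j → I₃ j * x j)
    ≡⟨ cong (λ q → 2ℚ * extend x a + -1ℚ * extend x (suc a) + -1ℚ * q) (sumFin-indicator-suc x a) ⟩
  2ℚ * extend x a + -1ℚ * extend x (suc a) + -1ℚ * extend-previous x a ∎
  where
  open ≡-Reasoning
  a = toℕ i
  I₁ I₂ I₃ : Fin m → ℚ
  I₁ j = indicator (a ≡ᵇ toℕ j)
  I₂ j = indicator (suc a ≡ᵇ toℕ j)
  I₃ j = indicator (a ≡ᵇ suc (toℕ j))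
  distrib : ∀ p q r y → (2ℚ * p + -1ℚ * q + -1ℚ * r) * y ≡ 2ℚ * (p * y) + -1ℚ * (q * y) + -1ℚ * (r * y)
  distrib = solve 4 (λ p q r y → (con 2ℚ :* p :+ con -1ℚ :* q :+ con -1ℚ :* r) :* y
                             := con 2ℚ :* (p :* y) :+ con -1ℚ :* (q :* y) :+ con -1ℚ :* (r :* y)) refl

Lcyc-recurrence : ∀ {m} (x : Fin m → ℚ) (i : Fin m) → extend x (suc (toℕ i)) ≡
  2ℚ * extend x (toℕ i) + -1ℚ * extend-previous x (toℕ i) + -1ℚ * (Lcyc m *ᵥ x) i
Lcyc-recurrence x i =
  trans (solve-for-next xₐ xₐ₊₁ xₐ₋₁) (cong (λ t → 2ℚ * xₐ + -1ℚ * xₐ₋₁ + -1ℚ * t) (sym (Lcyc-row x i)))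
  where
  xₐ₋₁ = extend-previous x (toℕ i)
  xₐ   = extend x (toℕ i)
  xₐ₊₁ = extend x (suc (toℕ i))
  solve-for-next : ∀ p q r → q ≡ 2ℚ * p + -1ℚ * r + -1ℚ * (2ℚ * p + -1ℚ * q + -1ℚ * r)
  solve-for-next = solve 3 (λ p q r → q := con 2ℚ :* p :+ con -1ℚ :* r
                                          :+ con -1ℚ :* (con 2ℚ :* p :+ con -1ℚ :* q :+ con -1ℚ :* r)) refl

Lcyc-integral : ∀ {k} (x : Fin (suc k) → ℚ) → (∀ i → IsInt ((Lcyc (suc k) *ᵥ x) i)) →
  IsInt (x zero) → ∀ i → IsInt (x i)
Lcyc-integral {k} x Lx-int x₀-int i = subst IsInt (extend-toℕ x i) (proj₂ (consecutive (toℕ i)))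
  where
  next-in-range : ∀ i → IsInt (extend-previous x (toℕ i)) × IsInt (extend x (toℕ i)) →
    IsInt (extend x (suc (toℕ i)))
  next-in-range i (xₐ₋₁-int , xₐ-int) = subst IsInt (sym (Lcyc-recurrence x i))
    (IsInt-+ (IsInt-+ (IsInt-* IsInt-2 xₐ-int) (IsInt-* IsInt--1 xₐ₋₁-int)) (IsInt-* IsInt--1 (Lx-int i)))

  next : ∀ a → IsInt (extend-previous x a) × IsInt (extend x a) → IsInt (extend x (suc a))
  next a ints with a <? suc k
  ... | yes a<m = subst (λ b → IsInt (extend x (suc b))) (toℕ-fromℕ< a<m)
    (next-in-range (fromℕ< a<m)
      (subst (λ b → IsInt (extend-previous x b) × IsInt (extend x b)) (sym (toℕ-fromℕ< a<m)) ints))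
  ... | no  a≮m = subst IsInt (sym (extend-≥ x (ℕ.m≤n⇒m≤1+n (ℕ.≮⇒≥ a≮m)))) IsInt-0

  consecutive : ∀ a → IsInt (extend-previous x a) × IsInt (extend x a)
  consecutive ℕ.zero    = IsInt-0 , subst IsInt (sym (extend-toℕ x zero)) x₀-int
  consecutive (suc a) = proj₂ (consecutive a) , next a (consecutive a)

proposition4p3 : (k : ℕ) → (Linv : Mat (suc k)) → IsInverse (Lcyc (suc k)) Linv
    → (x : Fin (suc k) → ℚ)
    → (∃ λ (t : Fin (suc k) → ℚ) → (∀ j → (0ℚ ≤ t j) × (t j < 1ℚ))
    × (∀ i → x i ≡ sumFin (λ j → t j * ((+ suc (suc k) / 1) * Linv i j))))
    → (∃ λ (c : Fin (suc k) → Fin (suc (suc k)))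
    → ∀ i → x i ≡ sumFin (λ j → Linv i j * (+ toℕ (c j) / 1)))
    → ((∀ i → IsInt (x i)) ⇔ IsInt (x zero))
proposition4p3 k Linv (L·Linv≡I , _) x _ (c , x≡Linv*c) = mk⇔ (λ x-int → x-int zero) (Lcyc-integral x Lx-int)
  where
  Lx-int : ∀ i → IsInt ((Lcyc (suc k) *ᵥ x) i)
  Lx-int i = subst IsInt
    (sym (trans (sumFin-cong (λ j → cong (Lcyc (suc k) i j *_) (x≡Linv*c j)))
                (*ᵥ-rightInverse (Lcyc (suc k)) Linv L·Linv≡I (λ j → + toℕ (c j) / 1) i)))
    (+ toℕ (c i) , refl)
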